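{- Let $(P,\Pi\cup\theta\Pi)$ be a permutation-bipartition pair such that $\{b\}$ is a block of $\Pi$ (and $\{\theta b\}$ a block of $\theta\Pi$). Then for every integer $k$, $$r_{(P,\Pi\cup\theta\Pi)}(2k)=r_{(P,\Pi\cup\theta\Pi)|^{b\rightarrow b}_{\theta b\rightarrow\theta b}}\big(2k-\delta_{b,bP}-\delta_{\theta b,\theta bP_b}\big).$$
   Context: Let $S$ and $S_\theta$ be disjoint finite sets of equal size and $\theta$ a fixed-point-free involution of $S\cup S_\theta$ mapping $S$ onto $S_\theta$. Permutations act on the right ($xP$ is the image of $x$, $x(PQ)=(xP)Q$). $\|P\|$ is the number of cycles of $P$ (fixed points counted). A permutation-bipartition pair $(P,\Pi\cup\theta\Pi)$ consists of a permutation $P$ of $S\cup S_\theta$ such that whenever $(x_1,x_2,\ldots,x_m)$ is a cycle of $P$, $(\theta x_1,\theta x_m,\ldots,\theta x_2)$ is also a cycle, a partition $\Pi=\{\Pi_1,\ldots,\Pi_k\}$ of $S$ and $\theta\Pi=\{\theta\Pi_i\}$. An embedding is a permutation $Q$ whose cycles are, for each block $\Pi_i=\{a_1,\ldots,a_m\}$, a cycle $(a_{j_1},\ldots,a_{j_m})$ and the cycle $(\theta a_{j_m},\ldots,\theta a_{j_2},\theta a_{j_1})$ for some ordering $j_1,\ldots,j_m$; $S(\Pi\cup\theta\Pi)$ is the set of embeddings. The orbit distribution is $r_{(P,\Pi\cup\theta\Pi)}(m)=\#\{Q\in S(\Pi\cup\theta\Pi):\|PQ\|=m\}$. $P/x$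 deletes $x$ from the cycle decomposition of $P$. For a singleton block $\{b\}$: $P_b=P/b$, $P_{b,\theta b}=P_b/\theta b$, $\Pi_b$ and $\theta\Pi_b$ are $\Pi$ and $\theta\Pi$ with the blocks $\{b\}$, $\{\theta b\}$ removed, and $(P,\Pi\cup\theta\Pi)|^{b\rightarrow b}_{\theta b\rightarrow\theta b}=(P_{b,\theta b},\Pi_b\cup\theta\Pi_b)$. -}

module Defs where

open import Data.Bool using (Bool; true; false; if_then_else_; not)
open import Data.Nat using (ℕ; zero; suc)
open import Data.Maybe using (Maybe; just; nothing)
open import Data.List using (List; []; _∷_; _++_; map; reverse; length; concat; concatMap; upTo)
open import Data.Bool.ListAction using (any; all)
open import Data.List.Properties using (≡-dec)
open import Data.List.Membership.Propositional using (_∈_; _∉_)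
open import Data.List.Relation.Unary.Unique.Propositional using (Unique)
open import Data.List.Relation.Binary.Permutation.Propositional using (_↭_)
open import Data.Product using (_×_)
open import Data.Integer as ℤ using (ℤ; +_)
open import Relation.Nullary using (does; ¬_)
open import Relation.Binary.Definitions using (DecidableEquality)
open import Relation.Binary.PropositionalEquality using (_≡_; _≢_)

filterB : {A : Set} → (A → Bool) → List A → List A
filterB p [] = []
filterB p (x ∷ xs) = if p x then x ∷ filterB p xs else filterB p xs

module _ {A : Set} (_≟_ : DecidableEquality A) where

  _==_ : A → A → Bool
  x == y = does (x ≟ y)

  δ : A → A → ℕ
  δ x y = if x == y then 1 else 0

  -- Counting cycles of a permutation R of a finite domain D (fixed points
  -- counted): the number of orbits of R on D.  An element of D is counted
  -- iff it lies in no orbit of an earlier element of D.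

  -- iter R j x = x R^j  (right action)
  iter : (A → A) → ℕ → A → A
  iter R zero x = x
  iter R (suc j) x = iter R j (R x)

  -- y lies in the R-orbit of x (orbits on D have length ≤ n = |D|)
  inOrbit : (A → A) → ℕ → A → A → Bool
  inOrbit R n x y = any (λ j → iter R j x == y) (upTo n)

  countReps : (A → A) → ℕ → List A → List A → ℕ
  countReps R n seen [] = 0
  countReps R n seen (x ∷ xs) =
    if any (λ s → inOrbit R n s x) seen
    then countReps R n (x ∷ seen) xs
    else suc (countReps R n (x ∷ seen) xs)

  ncycles : (A → A) → List A → ℕ
  ncycles R D = countReps R (length D) [] D

  -- successor of y in the cycle (h ... ) whose remaining part is given
  nextIn : A → List A → A → Maybe A
  nextIn h [] y = nothing
  nextIn h (x ∷ []) y = if x == y then just h else nothing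
  nextIn h (x ∷ x' ∷ xs) y = if x == y then just x' else nextIn h (x' ∷ xs) y

  cycFun : List (List A) → A → A
  cycFun [] y = y
  cycFun ([] ∷ cs) y = cycFun cs y
  cycFun ((h ∷ t) ∷ cs) y with nextIn h (h ∷ t) y
  ... | just z = z
  ... | nothing = cycFun cs y

  insertAll : A → List A → List (List A)
  insertAll x [] = (x ∷ []) ∷ []
  insertAll x (y ∷ ys) = (x ∷ y ∷ ys) ∷ map (y ∷_) (insertAll x ys)

  perms : List A → List (List A)
  perms [] = [] ∷ []
  perms (x ∷ xs) = concatMap (insertAll x) (perms xs)

  choices : List (List A) → List (List (List A))
  choices [] = [] ∷ []
  choices (B ∷ Bs) = concatMap (λ o → map (o ∷_) (choices Bs)) (perms B)

  -- Deletion P / x : remove x from the cycle decomposition of P.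
  del : (A → A) → A → (A → A)
  del P x y = if P y == x then P x else P y

  removeElt : List A → A → List A
  removeElt S b = filterB (λ x → not (x == b)) S

  removeBlock : List (List A) → A → List (List A)
  removeBlock Π b = filterB (λ B → not (does (≡-dec _≟_ B (b ∷ [])))) Π

  agreeOn : List A → (A → A) → (A → A) → Bool
  agreeOn D Q Q' = all (λ x → Q x == Q' x) D

  distinctOn : List A → List (A → A) → List (A → A) → List (A → A)
  distinctOn D acc [] = acc
  distinctOn D acc (Q ∷ Qs) =
    if any (agreeOn D Q) acc then distinctOn D acc Qs else distinctOn D (Q ∷ acc) Qs

  module _ (θ : A → A) where

    dom : List A → List A
    dom S = S ++ map θ S

    -- the embedding Q determined by an ordering (a_{j1},…,a_{jm}) of each block:
    -- cycles (a_{j1},…,a_{jm}) and (θa_{jm},…,θa_{j1})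
    embeddingOf : List (List A) → A → A
    embeddingOf os = cycFun (os ++ map (λ o → reverse (map θ o)) os)

    embeddings : List A → List (List A) → List (A → A)
    embeddings S Π = distinctOn (dom S) [] (map embeddingOf (choices Π))

    -- orbit distribution r_{(P,Π∪θΠ)}(m) = #{Q ∈ S(Π∪θΠ) : ‖PQ‖ = m};
    -- x(PQ) = (xP)Q
    r : List A → (A → A) → List (List A) → ℤ → ℕ
    r S P Π m =
      length (filterB (λ Q → does ((+ ncycles (λ x → Q (P x)) (dom S)) ℤ.≟ m))
                      (embeddings S Π))

    -- standing assumptions: S finite (duplicate-free list), θ an involution
    -- with θ S disjoint from S (so θ is a fixed-point-free involution of
    -- S ∪ S_θ mapping S onto S_θ = θ S)
    record IsInvolutionSetup (S : List A) : Set where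
      field
        uniqueS   : Unique S
        involutive : ∀ {x} → x ∈ S → θ (θ x) ≡ x
        disjoint  : ∀ {x} → x ∈ S → θ x ∉ S

    record IsPBPair (S : List A) (P : A → A) (Π : List (List A)) : Set where
      field
        closed    : ∀ {x} → x ∈ dom S → P x ∈ dom S
        injective : ∀ {x y} → x ∈ dom S → y ∈ dom S → P x ≡ P y → x ≡ y
        -- if (x_1,…,x_m) is a cycle then so is (θx_1,θx_m,…,θx_2):
        -- i.e. (θ (xP)) P = θ x
        symmetric : ∀ {x} → x ∈ dom S → P (θ (P x)) ≡ θ x
        nonempty  : ∀ {B} → B ∈ Π → B ≢ []
        covers    : concat Π ↭ S

-- Every embedding Q of (P, Π ∪ θΠ) fixes b and θ b, and dropping the singleton blocks {b}, {θ b}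
-- matches these embeddings one-to-one with the embeddings Q′ of the reduced pair, Q′ agreeing with
-- Q away from b and θ b. As Q fixes b and θ b, deleting first b and then θ b from PQ yields
-- P_{b,θb} Q′. Deleting a point from a permutation keeps the number of cycles, except that a fixed
-- point takes its cycle with it. Hence ‖PQ‖ = ‖P_{b,θb} Q′‖ + δ_{θb,θbP_b} + δ_{b,bP}, and the
-- orbit distribution is shifted accordingly at every argument, even or not.
{-# OPTIONS --safe #-}
module Submission where

open import Data.Bool using (Bool; true; false; if_then_else_; _∨_)
open import Data.Bool.ListAction using (any; all)
open import Data.Bool.Properties using (T-≡; ∨-assoc; ∨-comm; if-float)
open import Data.Fin using (toℕ)
open import Data.Fin.Properties using (pigeonhole; toℕ<n)
open import Data.Integer as ℤ using (ℤ; +_; _*_; _-_)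
import Data.Integer.Properties as ℤ
open import Data.Integer.Tactic.RingSolver using (solve-∀)
open import Data.List using (List; []; _∷_; _++_; map; length; concat; reverse; upTo; filter; lookup)
open import Data.List.Membership.Propositional using (_∈_; _∉_; find; lose)
open import Data.List.Membership.Propositional.Properties
  using (∈-filter⁺; ∈-filter⁻; ∈-++⁻; ∈-++⁺ˡ; ∈-++⁺ʳ; ∈-concat⁻′; ∈-concat⁺′; ∈-map⁺; ∈-map⁻; ∈-upTo⁺; ∈-∃++)
open import Data.List.Properties using (≡-dec; ++-assoc; map-++; ++-identityʳ; concat-++; filter-++; filter-all)
open import Data.List.Relation.Binary.Permutation.Propositional as ↭ using (_↭_; ↭-sym; ↭-refl; prep; swap; ↭⇒↭ₛ)
import Data.List.Relation.Binary.Permutation.Propositional.Properties as ↭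
import Data.List.Relation.Binary.Permutation.Setoid.Properties as ↭ₛ
open import Data.List.Relation.Binary.Pointwise as Pointwise using (Pointwise; []; _∷_)
open import Data.List.Relation.Binary.Subset.Propositional using (_⊆_)
open import Data.List.Relation.Unary.All as All using (All; []; _∷_)
open import Data.List.Relation.Unary.All.Properties
  using (all⁺; all⁻) renaming (++⁻ˡ to All-++⁻ˡ; ++⁻ʳ to All-++⁻ʳ; map⁺ to All-map⁺; concat⁺ to All-concat⁺)
open import Data.List.Relation.Unary.AllPairs using ([]; _∷_)
open import Data.List.Relation.Unary.Any using (here; there; index)
open import Data.List.Relation.Unary.Any.Properties using (any⁺; any⁻; lookup-index)
open import Data.List.Relation.Unary.Unique.Propositional using (Unique)
open import Data.List.Relation.Unary.Unique.Propositional.Properties as Unique using (Unique[x∷xs]⇒x∉xs)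
open import Data.Maybe using (just; nothing)
open import Data.Nat as ℕ using (ℕ; zero; suc; _+_; _∸_; _≤_; _<_)
open import Data.Nat.DivMod using (_%_; _/_; m≡m%n+[m/n]*n; m%n<n)
import Data.Nat.Properties as ℕ
open import Data.Product using (∃; ∃₂; _×_; _,_; proj₁; proj₂; map₂)
open import Data.Sum using (_⊎_; inj₁; inj₂)
open import Function using (_∘_; _⇔_; Equivalence; mk⇔)
open import Relation.Binary.Definitions using (DecidableEquality)
open import Relation.Binary.PropositionalEquality
  using (_≡_; _≢_; refl; sym; trans; cong; cong₂; subst; setoid; module ≡-Reasoning)
open import Relation.Nullary using (Dec; does; yes; no; contradiction; ¬?)
open import Relation.Nullary.Decidable using (dec-true; does-⇔)
open import Relation.Unary using (Decidable)

open import Defs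

private
  variable
    X Y : Set

true⇔true⇒≡ : ∀ {a b : Bool} → (a ≡ true → b ≡ true) → (b ≡ true → a ≡ true) → a ≡ b
true⇔true⇒≡ {false} {false} _ _ = refl
true⇔true⇒≡ {false} {true}  _ g = g refl
true⇔true⇒≡ {true}  {false} f _ = sym (f refl)
true⇔true⇒≡ {true}  {true}  _ _ = refl

≢true⇒≡false : ∀ {a} → a ≢ true → a ≡ false
≢true⇒≡false {false} _ = refl
≢true⇒≡false {true}  h = contradiction refl h

false≢true : false ≢ true
false≢true ()

any≡true⁻ : ∀ (f : X → Bool) xs → any f xs ≡ true → ∃ λ x → x ∈ xs × f x ≡ true
any≡true⁻ f xs h = map₂ (map₂ (Equivalence.to T-≡)) (find (any⁻ f xs (Equivalence.from T-≡ h)))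

any≡true⁺ : ∀ (f : X → Bool) {xs x} → x ∈ xs → f x ≡ true → any f xs ≡ true
any≡true⁺ f x∈xs fx = Equivalence.to T-≡ (any⁺ f (lose x∈xs (Equivalence.from T-≡ fx)))

any≡false⁻ : ∀ (f : X → Bool) {xs x} → any f xs ≡ false → x ∈ xs → f x ≡ false
any≡false⁻ f h x∈xs = ≢true⇒≡false λ fx → false≢true (trans (sym h) (any≡true⁺ f x∈xs fx))

any≡false⁺ : ∀ (f : X → Bool) xs → (∀ {x} → x ∈ xs → f x ≡ false) → any f xs ≡ false
any≡false⁺ f xs h = ≢true⇒≡false λ e →
  let (x , x∈xs , fx) = any≡true⁻ f xs e in false≢true (trans (sym (h x∈xs)) fx)

any-cong : ∀ (f g : X → Bool) xs → (∀ {x} → x ∈ xs → f x ≡ g x) → any f xs ≡ any g xs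
any-cong f g []       h = refl
any-cong f g (x ∷ xs) h = cong₂ _∨_ (h (here refl)) (any-cong f g xs (h ∘ there))

any-pointwise : ∀ (_∼_ : X → Y → Set) (f : X → Bool) (g : Y → Bool) {xs ys} →
                (∀ {x y} → x ∼ y → f x ≡ g y) → Pointwise _∼_ xs ys → any f xs ≡ any g ys
any-pointwise _∼_ f g h []       = refl
any-pointwise _∼_ f g h (r ∷ rs) = cong₂ _∨_ (h r) (any-pointwise _∼_ f g h rs)

all≡true⁻ : ∀ (f : X → Bool) xs → all f xs ≡ true → ∀ {x} → x ∈ xs → f x ≡ true
all≡true⁻ f xs h = Equivalence.to T-≡ ∘ All.lookup (all⁺ f xs (Equivalence.from T-≡ h))

all≡true⁺ : ∀ (f : X → Bool) xs → (∀ {x} → x ∈ xs → f x ≡ true) → all f xs ≡ true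
all≡true⁺ f xs h = Equivalence.to T-≡ (all⁻ f (All.tabulate (Equivalence.from T-≡ ∘ h)))

filterB-filter : ∀ {P : X → Set} (P? : Decidable P) xs → filterB (does ∘ P?) xs ≡ filter P? xs
filterB-filter P? []       = refl
filterB-filter P? (x ∷ xs) with does (P? x)
... | true  = cong (x ∷_) (filterB-filter P? xs)
... | false = filterB-filter P? xs

length-filterB-pointwise : ∀ (_∼_ : X → Y → Set) (p : X → Bool) (q : Y → Bool) {xs ys} →
  (∀ {x y} → x ∼ y → p x ≡ q y) → Pointwise _∼_ xs ys → length (filterB p xs) ≡ length (filterB q ys)
length-filterB-pointwise _∼_ p q h [] = refl
length-filterB-pointwise _∼_ p q {x ∷ _} {y ∷ _} h (r ∷ rs) rewrite h r with q y
... | true  = cong suc (length-filterB-pointwise _∼_ p q h rs)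
... | false = length-filterB-pointwise _∼_ p q h rs

Unique-resp-↭ : ∀ {xs ys : List X} → xs ↭ ys → Unique xs → Unique ys
Unique-resp-↭ p = ↭ₛ.Unique-resp-↭ (setoid _) (↭⇒↭ₛ p)

Pointwise-mapWithAll : ∀ {R S : X → Y → Set} {P : X → Set} {xs ys} →
  (∀ {x y} → R x y → P x → S x y) → Pointwise R xs ys → All P xs → Pointwise S xs ys
Pointwise-mapWithAll f []       []       = []
Pointwise-mapWithAll f (r ∷ rs) (p ∷ ps) = f r p ∷ Pointwise-mapWithAll f rs ps

concat-↭ : ∀ {xss yss : List (List X)} → Pointwise _↭_ xss yss → concat xss ↭ concat yss
concat-↭ []               = ↭-refl
concat-↭ (xs↭ys ∷ xss↭) = ↭.++⁺ xs↭ys (concat-↭ xss↭)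

Unique-++⁻ : ∀ xs {ys : List X} → Unique (xs ++ ys) → Unique xs × Unique ys × (∀ {z} → z ∈ xs → z ∉ ys)
Unique-++⁻ []       u          = [] , u , λ ()
Unique-++⁻ (x ∷ xs) (x∉ ∷ u) =
  let (u-xs , u-ys , disjoint) = Unique-++⁻ xs u in
  All-++⁻ˡ xs x∉ ∷ u-xs , u-ys , λ { (here refl) z∈ys → All.lookup (All-++⁻ʳ xs x∉) z∈ys refl ; (there z∈xs) → disjoint z∈xs }

module _ {A : Set} (_≟_ : DecidableEquality A) where

  ==⇒≡ : ∀ {x y} → _==_ _≟_ x y ≡ true → x ≡ y
  ==⇒≡ {x} {y} h with x ≟ y
  ... | yes x≡y = x≡y

  removeElt≡filter : ∀ xs b → removeElt _≟_ xs b ≡ filter (λ x → ¬? (x ≟ b)) xs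
  removeElt≡filter xs b = filterB-filter (λ x → ¬? (x ≟ b)) xs

  ∈-removeElt⁻ : ∀ {xs b y} → y ∈ removeElt _≟_ xs b → y ∈ xs × y ≢ b
  ∈-removeElt⁻ {xs} {b} {y} = ∈-filter⁻ (λ x → ¬? (x ≟ b)) ∘ subst (y ∈_) (removeElt≡filter xs b)

  ∈-removeElt⁺ : ∀ {xs b y} → y ∈ xs → y ≢ b → y ∈ removeElt _≟_ xs b
  ∈-removeElt⁺ {xs} {b} {y} y∈xs y≢b =
    subst (y ∈_) (sym (removeElt≡filter xs b)) (∈-filter⁺ (λ x → ¬? (x ≟ b)) y∈xs y≢b)

  removeElt-++ : ∀ xs ys b → removeElt _≟_ (xs ++ ys) b ≡ removeElt _≟_ xs b ++ removeElt _≟_ ys b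
  removeElt-++ xs ys b = begin
    removeElt _≟_ (xs ++ ys) b                        ≡⟨ removeElt≡filter (xs ++ ys) b ⟩
    filter (λ x → ¬? (x ≟ b)) (xs ++ ys)              ≡⟨ filter-++ (λ x → ¬? (x ≟ b)) xs ys ⟩
    filter (λ x → ¬? (x ≟ b)) xs ++ filter (λ x → ¬? (x ≟ b)) ys
                                                      ≡⟨ sym (cong₂ _++_ (removeElt≡filter xs b) (removeElt≡filter ys b)) ⟩
    removeElt _≟_ xs b ++ removeElt _≟_ ys b          ∎
    where open ≡-Reasoning

  removeElt-∉ : ∀ {xs b} → b ∉ xs → removeElt _≟_ xs b ≡ xs
  removeElt-∉ {xs} {b} b∉xs = trans (removeElt≡filter xs b)
    (filter-all (λ x → ¬? (x ≟ b)) (All.tabulate λ x∈xs x≡b → b∉xs (subst (_∈ xs) x≡b x∈xs)))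

  removeElt-head : ∀ xs b → removeElt _≟_ (b ∷ xs) b ≡ removeElt _≟_ xs b
  removeElt-head xs b rewrite dec-true (b ≟ b) refl = refl

  removeElt-unique : ∀ {xs} b → Unique xs → Unique (removeElt _≟_ xs b)
  removeElt-unique {xs} b u = subst Unique (sym (removeElt≡filter xs b)) (Unique.filter⁺ (λ x → ¬? (x ≟ b)) u)

  removeElt-map : ∀ (f : A → A) b xs → (∀ {x} → x ∈ xs → f x ≡ f b → x ≡ b) →
                  removeElt _≟_ (map f xs) (f b) ≡ map f (removeElt _≟_ xs b)
  removeElt-map f b []       inj = refl
  removeElt-map f b (x ∷ xs) inj with x ≟ b | f x ≟ f b
  ... | yes _   | yes _    = removeElt-map f b xs (inj ∘ there)
  ... | no _    | no _     = cong (f x ∷_) (removeElt-map f b xs (inj ∘ there))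
  ... | yes x≡b | no fx≢fb = contradiction (cong f x≡b) fx≢fb
  ... | no x≢b  | yes fx≡fb = contradiction (inj (here refl) fx≡fb) x≢b

  distinctOn-pointwise : ∀ (_∼_ : (A → A) → (A → A) → Set) D D' →
    (∀ {Q Q' R R'} → Q ∼ Q' → R ∼ R' → agreeOn _≟_ D Q R ≡ agreeOn _≟_ D' Q' R') →
    ∀ {acc acc' Qs Qs'} → Pointwise _∼_ acc acc' → Pointwise _∼_ Qs Qs' →
    Pointwise _∼_ (distinctOn _≟_ D acc Qs) (distinctOn _≟_ D' acc' Qs')
  distinctOn-pointwise _∼_ D D' agree acc∼ [] = acc∼
  distinctOn-pointwise _∼_ D D' agree {acc} {acc'} {Q ∷ _} {Q' ∷ _} acc∼ (q∼ ∷ qs∼)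
    rewrite any-pointwise _∼_ (agreeOn _≟_ D Q) (agreeOn _≟_ D' Q') (agree q∼) acc∼
    with any (agreeOn _≟_ D' Q') acc'
  ... | true  = distinctOn-pointwise _∼_ D D' agree acc∼ qs∼
  ... | false = distinctOn-pointwise _∼_ D D' agree (q∼ ∷ acc∼) qs∼

record IsPermutationOn {A : Set} (D : List A) (R : A → A) : Set where
  field
    closed    : ∀ {x} → x ∈ D → R x ∈ D
    injective : ∀ {x y} → x ∈ D → y ∈ D → R x ≡ R y → x ≡ y

∘-isPermutationOn : ∀ {A : Set} {D : List A} {Q R : A → A} →
                    IsPermutationOn D Q → IsPermutationOn D R → IsPermutationOn D (Q ∘ R)
∘-isPermutationOn Q-perm R-perm = record
  { closed    = Q.closed ∘ R.closed
  ; injective = λ x∈D y∈D e → R.injective x∈D y∈D (Q.injective (R.closed x∈D) (R.closed y∈D) e)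
  }
  where module Q = IsPermutationOn Q-perm
        module R = IsPermutationOn R-perm

↭-isPermutationOn : ∀ {A : Set} {D D′ : List A} {R : A → A} → D ↭ D′ → IsPermutationOn D R → IsPermutationOn D′ R
↭-isPermutationOn D↭D′ R-perm = record
  { closed    = ↭.∈-resp-↭ D↭D′ ∘ closed ∘ ↭.∈-resp-↭ (↭-sym D↭D′)
  ; injective = λ x∈D′ y∈D′ → injective (↭.∈-resp-↭ (↭-sym D↭D′) x∈D′) (↭.∈-resp-↭ (↭-sym D↭D′) y∈D′)
  }
  where open IsPermutationOn R-perm

module Orbits {A : Set} (_≟_ : DecidableEquality A) where

  Reaches : (A → A) → A → A → Set
  Reaches R x y = ∃ λ m → iter _≟_ R m x ≡ y

  iter-+ : ∀ R a b x → iter _≟_ R (a + b) x ≡ iter _≟_ R b (iter _≟_ R a x)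
  iter-+ R zero    b x = refl
  iter-+ R (suc a) b x = iter-+ R a b (R x)

  iter-suc : ∀ R j x → iter _≟_ R j (R x) ≡ R (iter _≟_ R j x)
  iter-suc R zero    x = refl
  iter-suc R (suc j) x = iter-suc R j (R x)

  iter-fixed : ∀ R {b} k → R b ≡ b → iter _≟_ R k b ≡ b
  iter-fixed R zero    Rb≡b = refl
  iter-fixed R (suc k) Rb≡b rewrite Rb≡b = iter-fixed R k Rb≡b

  iter-*-periodic : ∀ R p x q → iter _≟_ R p x ≡ x → iter _≟_ R (q ℕ.* p) x ≡ x
  iter-*-periodic R p x zero    e = refl
  iter-*-periodic R p x (suc q) e = begin
    iter _≟_ R (p + q ℕ.* p) x             ≡⟨ iter-+ R p (q ℕ.* p) x ⟩
    iter _≟_ R (q ℕ.* p) (iter _≟_ R p x)  ≡⟨ cong (iter _≟_ R (q ℕ.* p)) e ⟩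
    iter _≟_ R (q ℕ.* p) x                 ≡⟨ iter-*-periodic R p x q e ⟩
    x                                      ∎
    where open ≡-Reasoning

  Reaches-trans : ∀ R {x y z} → Reaches R x y → Reaches R y z → Reaches R x z
  Reaches-trans R {x} (a , x↝y) (b , y↝z) =
    a + b , trans (iter-+ R a b x) (trans (cong (iter _≟_ R b) x↝y) y↝z)

  module _ {D : List A} {R : A → A} (R-perm : IsPermutationOn D R) where
    open IsPermutationOn R-perm

    iter-closed : ∀ {x} j → x ∈ D → iter _≟_ R j x ∈ D
    iter-closed zero    x∈D = x∈D
    iter-closed (suc j) x∈D = iter-closed j (closed x∈D)

    iter-cancel : ∀ {x} i k → x ∈ D → iter _≟_ R i x ≡ iter _≟_ R (i + k) x → x ≡ iter _≟_ R k x
    iter-cancel zero        k x∈D e = e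
    iter-cancel {x} (suc i) k x∈D e =
      injective x∈D (iter-closed k x∈D) (trans (iter-cancel i k (closed x∈D) e) (iter-suc R k x))

    reaches-fixed⇒≡ : ∀ {b y} m → b ∈ D → R b ≡ b → y ∈ D → iter _≟_ R m y ≡ b → y ≡ b
    reaches-fixed⇒≡ zero    b∈D Rb≡b y∈D y↝b = y↝b
    reaches-fixed⇒≡ (suc m) b∈D Rb≡b y∈D y↝b =
      injective y∈D b∈D (trans (reaches-fixed⇒≡ m b∈D Rb≡b (closed y∈D) y↝b) (sym Rb≡b))

    -- The |D| + 1 points x, xR, …, xR^|D| of D cannot all be distinct.
    period : ∀ {x} → x ∈ D → ∃ λ p → iter _≟_ R (suc p) x ≡ x × suc p ≤ length D
    period {x} x∈D with pigeonhole (ℕ.n<1+n (length D)) (λ i → index (iter-closed (toℕ i) x∈D))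
    ... | i , j , i<j , same-index =
      positive (toℕ j ∸ toℕ i) (ℕ.m<n⇒0<n∸m i<j)
        (ℕ.≤-trans (ℕ.m∸n≤m (toℕ j) (toℕ i)) (ℕ.m<1+n⇒m≤n (toℕ<n j)))
        (iter-cancel (toℕ i) (toℕ j ∸ toℕ i) x∈D (trans repeat (cong (λ t → iter _≟_ R t x) (sym (ℕ.m+[n∸m]≡n (ℕ.<⇒≤ i<j))))))
      where
        repeat : iter _≟_ R (toℕ i) x ≡ iter _≟_ R (toℕ j) x
        repeat = trans (lookup-index (iter-closed (toℕ i) x∈D))
                   (trans (cong (lookup D) same-index) (sym (lookup-index (iter-closed (toℕ j) x∈D))))
        positive : ∀ k → 0 < k → k ≤ length D → x ≡ iter _≟_ R k x → ∃ λ p → iter _≟_ R (suc p) x ≡ x × suc p ≤ length D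
        positive (suc p) _ p<∣D∣ e = p , sym e , p<∣D∣

    reaches-within : ∀ {x y} m → x ∈ D → iter _≟_ R m x ≡ y → ∃ λ j → j < length D × iter _≟_ R j x ≡ y
    reaches-within {x} {y} m x∈D x↝y with period x∈D
    ... | p , cycle , p<∣D∣ =
      m % suc p , ℕ.≤-trans (m%n<n m (suc p)) p<∣D∣ , (begin
        iter _≟_ R (m % suc p) x                                  ≡⟨ cong (iter _≟_ R (m % suc p)) (sym (iter-*-periodic R (suc p) x (m / suc p) cycle)) ⟩
        iter _≟_ R (m % suc p) (iter _≟_ R (m / suc p ℕ.* suc p) x) ≡⟨ sym (iter-+ R (m / suc p ℕ.* suc p) (m % suc p) x) ⟩
        iter _≟_ R (m / suc p ℕ.* suc p + m % suc p) x            ≡⟨ cong (λ t → iter _≟_ R t x) (trans (ℕ.+-comm _ (m % suc p)) (sym (m≡m%n+[m/n]*n m (suc p)))) ⟩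
        iter _≟_ R m x                                            ≡⟨ x↝y ⟩
        y                                                         ∎)
      where open ≡-Reasoning

    Reaches-sym : ∀ {x y} → x ∈ D → Reaches R x y → Reaches R y x
    Reaches-sym {x} {y} x∈D (m , x↝y) with period x∈D
    ... | p , cycle , _ = m ℕ.* p , (begin
      iter _≟_ R (m ℕ.* p) y                    ≡⟨ cong (iter _≟_ R (m ℕ.* p)) (sym x↝y) ⟩
      iter _≟_ R (m ℕ.* p) (iter _≟_ R m x)     ≡⟨ sym (iter-+ R m (m ℕ.* p) x) ⟩
      iter _≟_ R (m + m ℕ.* p) x                ≡⟨ cong (λ t → iter _≟_ R t x) (sym (ℕ.*-suc m p)) ⟩
      iter _≟_ R (m ℕ.* suc p) x                ≡⟨ iter-*-periodic R (suc p) x m cycle ⟩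
      x                                         ∎)
      where open ≡-Reasoning

    inOrbit⇒Reaches : ∀ {x y} → inOrbit _≟_ R (length D) x y ≡ true → Reaches R x y
    inOrbit⇒Reaches {x} {y} h with any≡true⁻ (λ j → _==_ _≟_ (iter _≟_ R j x) y) (upTo (length D)) h
    ... | j , _ , e = j , ==⇒≡ _≟_ e

    Reaches⇒inOrbit : ∀ {x y} → x ∈ D → Reaches R x y → inOrbit _≟_ R (length D) x y ≡ true
    Reaches⇒inOrbit {x} {y} x∈D (m , x↝y) with reaches-within m x∈D x↝y
    ... | j , j<∣D∣ , e = any≡true⁺ (λ j → _==_ _≟_ (iter _≟_ R j x) y) (∈-upTo⁺ j<∣D∣) (dec-true (iter _≟_ R j x ≟ y) e)

    inOrbit-sym : ∀ {x y} → x ∈ D → y ∈ D → inOrbit _≟_ R (length D) x y ≡ true → inOrbit _≟_ R (length D) y x ≡ true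
    inOrbit-sym x∈D y∈D = Reaches⇒inOrbit y∈D ∘ Reaches-sym x∈D ∘ inOrbit⇒Reaches

    inOrbit-trans : ∀ {x y z} → x ∈ D → inOrbit _≟_ R (length D) x y ≡ true →
                    inOrbit _≟_ R (length D) y z ≡ true → inOrbit _≟_ R (length D) x z ≡ true
    inOrbit-trans x∈D x∼y y∼z = Reaches⇒inOrbit x∈D (Reaches-trans R (inOrbit⇒Reaches x∼y) (inOrbit⇒Reaches y∼z))

countClasses : (X → X → Bool) → List X → List X → ℕ
countClasses _∼_ seen []       = 0
countClasses _∼_ seen (x ∷ xs) =
  if any (_∼ x) seen then countClasses _∼_ (x ∷ seen) xs else suc (countClasses _∼_ (x ∷ seen) xs)

countClasses-cong-rel : ∀ (_∼_ _≈_ : X → X → Bool) (U : X → Set) seen xs →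
  (∀ {x y} → U x → U y → x ∼ y ≡ x ≈ y) → (∀ {s} → s ∈ seen → U s) → (∀ {x} → x ∈ xs → U x) →
  countClasses _∼_ seen xs ≡ countClasses _≈_ seen xs
countClasses-cong-rel _∼_ _≈_ U seen []       agree U-seen U-xs = refl
countClasses-cong-rel _∼_ _≈_ U seen (x ∷ xs) agree U-seen U-xs =
  cong₂ (λ a c → if a then c else suc c)
    (any-cong (_∼ x) (_≈ x) seen λ s∈seen → agree (U-seen s∈seen) (U-xs (here refl)))
    (countClasses-cong-rel _∼_ _≈_ U (x ∷ seen) xs agree
      (λ { (here refl) → U-xs (here refl) ; (there s∈seen) → U-seen s∈seen }) (U-xs ∘ there))

module _ (_∼_ : X → X → Bool) where

  countClasses-cong-seen : ∀ s₁ s₂ xs → (∀ {y} → y ∈ xs → any (_∼ y) s₁ ≡ any (_∼ y) s₂) →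
                           countClasses _∼_ s₁ xs ≡ countClasses _∼_ s₂ xs
  countClasses-cong-seen s₁ s₂ []       h = refl
  countClasses-cong-seen s₁ s₂ (x ∷ xs) h =
    cong₂ (λ a c → if a then c else suc c) (h (here refl))
      (countClasses-cong-seen (x ∷ s₁) (x ∷ s₂) xs (λ {y} y∈xs → cong ((x ∼ y) ∨_) (h (there y∈xs))))

  countClasses-swap-seen : ∀ a b seen xs → countClasses _∼_ (a ∷ b ∷ seen) xs ≡ countClasses _∼_ (b ∷ a ∷ seen) xs
  countClasses-swap-seen a b seen xs = countClasses-cong-seen _ _ xs λ {y} _ →
    trans (sym (∨-assoc (a ∼ y) (b ∼ y) _)) (trans (cong (_∨ any (_∼ y) seen) (∨-comm (a ∼ y) (b ∼ y))) (∨-assoc (b ∼ y) (a ∼ y) _))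

  countClasses-redundant : ∀ b seen xs → (∀ {y} → y ∈ xs → b ∼ y ≡ true → any (_∼ y) seen ≡ true) →
                           countClasses _∼_ (b ∷ seen) xs ≡ countClasses _∼_ seen xs
  countClasses-redundant b seen xs covered = countClasses-cong-seen _ _ xs absorb
    where
      absorb : ∀ {y} → y ∈ xs → (b ∼ y) ∨ any (_∼ y) seen ≡ any (_∼ y) seen
      absorb {y} y∈xs with b ∼ y in b∼y
      ... | true  = sym (covered y∈xs b∼y)
      ... | false = refl

  module _ (D : List X)
           (∼-sym   : ∀ {x y} → x ∈ D → y ∈ D → x ∼ y ≡ true → y ∼ x ≡ true)
           (∼-trans : ∀ {x y z} → x ∈ D → x ∼ y ≡ true → y ∼ z ≡ true → x ∼ z ≡ true) where

    ∼-sym-false : ∀ {x y} → x ∈ D → y ∈ D → x ∼ y ≡ false → y ∼ x ≡ false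
    ∼-sym-false x∈D y∈D x≁y = ≢true⇒≡false λ y∼x → false≢true (trans (sym x≁y) (∼-sym y∈D x∈D y∼x))

    countClasses-new-class : ∀ {b} seen xs → b ∈ D → seen ⊆ D → xs ⊆ D →
      any (_∼ b) seen ≡ false → (∃ λ y → y ∈ xs × y ∼ b ≡ true) →
      countClasses _∼_ seen xs ≡ suc (countClasses _∼_ (b ∷ seen) xs)
    countClasses-new-class seen [] b∈D seen⊆D xs⊆D b-new (_ , () , _)
    countClasses-new-class {b} seen (x ∷ xs) b∈D seen⊆D xs⊆D b-new (y , y∈x∷xs , y∼b) with x ∼ b in x∼b
    ... | true
      rewrite any≡false⁺ (_∼ x) seen (λ s∈seen → ≢true⇒≡false λ s∼x →
                false≢true (trans (sym b-new) (any≡true⁺ (_∼ b) s∈seen (∼-trans (seen⊆D s∈seen) s∼x x∼b))))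
            | ∼-sym (xs⊆D (here refl)) b∈D x∼b
      = cong suc (sym (trans (countClasses-swap-seen x b seen xs)
          (countClasses-redundant b (x ∷ seen) xs λ {z} _ b∼z → cong (_∨ any (_∼ z) seen) (∼-trans (xs⊆D (here refl)) x∼b b∼z))))
    ... | false
      rewrite ∼-sym-false (xs⊆D (here refl)) b∈D x∼b
      = begin
        (if a then c else suc c)                  ≡⟨ cong (λ c → if a then c else suc c) ih ⟩
        (if a then suc c′ else suc (suc c′))      ≡⟨ sym (if-float suc a) ⟩
        suc (if a then c′ else suc c′)            ∎
      where
        open ≡-Reasoning
        a : Bool
        a  = any (_∼ x) seen
        c c′ : ℕ
        c  = countClasses _∼_ (x ∷ seen) xs
        c′ = countClasses _∼_ (x ∷ b ∷ seen) xs
        y∈xs : y ∈ xs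
        y∈xs = tail-member y∈x∷xs
          where
            tail-member : y ∈ x ∷ xs → y ∈ xs
            tail-member (here refl)   = contradiction (trans (sym x∼b) y∼b) λ ()
            tail-member (there y∈xs′) = y∈xs′
        ih : c ≡ suc c′
        ih = trans (countClasses-new-class (x ∷ seen) xs b∈D
                     (λ { (here refl) → xs⊆D (here refl) ; (there s∈seen) → seen⊆D s∈seen })
                     (xs⊆D ∘ there) (cong₂ _∨_ x∼b b-new) (y , y∈xs , y∼b))
                   (cong suc (countClasses-swap-seen b x seen xs))

    data ClassIndicator (b : X) : ℕ → Set where
      singleton    : (∀ {y} → y ∈ D → y ∼ b ≡ true → y ≡ b) → ClassIndicator b 1
      nonSingleton : ∀ {y} → y ∈ D → y ≢ b → y ∼ b ≡ true → ClassIndicator b 0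

    countClasses-head : ∀ {b k} seen xs → ClassIndicator b k → b ∈ D → seen ⊆ D → xs ⊆ D →
      b ∉ seen → b ∉ xs → (∀ {y} → y ∈ D → y ∈ seen ⊎ y ∈ b ∷ xs) →
      countClasses _∼_ seen (b ∷ xs) ≡ countClasses _∼_ seen xs + k
    countClasses-head {b} seen xs (singleton alone) b∈D seen⊆D xs⊆D b∉seen b∉xs covers
      rewrite any≡false⁺ (_∼ b) seen (λ s∈seen → ≢true⇒≡false λ s∼b →
                b∉seen (subst (_∈ seen) (alone (seen⊆D s∈seen) s∼b) s∈seen))
      = trans (cong suc (countClasses-redundant b seen xs λ y∈xs b∼y →
                contradiction (subst (_∈ xs) (alone (xs⊆D y∈xs) (∼-sym b∈D (xs⊆D y∈xs) b∼y)) y∈xs) b∉xs))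
              (ℕ.+-comm 1 _)
    countClasses-head {b} seen xs (nonSingleton {y} y∈D y≢b y∼b) b∈D seen⊆D xs⊆D b∉seen b∉xs covers
      with any (_∼ b) seen in b-seen
    ... | true with any≡true⁻ (_∼ b) seen b-seen
    ...   | s , s∈seen , s∼b =
      trans (countClasses-redundant b seen xs λ _ b∼z → any≡true⁺ _ s∈seen (∼-trans (seen⊆D s∈seen) s∼b b∼z))
            (sym (ℕ.+-identityʳ _))
    countClasses-head {b} seen xs (nonSingleton {y} y∈D y≢b y∼b) b∈D seen⊆D xs⊆D b∉seen b∉xs covers
        | false with covers y∈D
    ...   | inj₁ y∈seen        = contradiction (trans (sym (any≡false⁻ (_∼ b) b-seen y∈seen)) y∼b) λ ()
    ...   | inj₂ (here y≡b)    = contradiction y≡b y≢b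
    ...   | inj₂ (there y∈xs) =
      trans (sym (countClasses-new-class seen xs b∈D seen⊆D xs⊆D b-seen (y , y∈xs , y∼b)))
            (sym (ℕ.+-identityʳ _))

    module _ (_≟_ : DecidableEquality X) {b k} (b-class : ClassIndicator b k) (b∈D : b ∈ D)
             (_≈_ : X → X → Bool) (≈-agrees : ∀ {x y} → x ∈ D → y ∈ D → x ≢ b → y ≢ b → x ≈ y ≡ x ∼ y) where

      countClasses-removeElt : ∀ seen xs → seen ⊆ D → xs ⊆ D → b ∉ seen → b ∈ xs → Unique xs →
        (∀ {y} → y ∈ D → y ∈ seen ⊎ y ∈ xs) →
        countClasses _∼_ seen xs ≡ countClasses _≈_ seen (removeElt _≟_ xs b) + k
      countClasses-removeElt seen (x ∷ xs) seen⊆D xs⊆D b∉seen b∈x∷xs (x∉xs ∷ u) covers with x ≟ b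
      ... | no x≢b = begin
        (if any (_∼ x) seen then countClasses _∼_ (x ∷ seen) xs else suc (countClasses _∼_ (x ∷ seen) xs))
          ≡⟨ cong₂ (λ a c → if a then c else suc c)
               (any-cong (_∼ x) (_≈ x) seen λ s∈seen →
                 sym (≈-agrees (seen⊆D s∈seen) (xs⊆D (here refl)) (λ s≡b → b∉seen (subst (_∈ seen) s≡b s∈seen)) x≢b))
               (countClasses-removeElt (x ∷ seen) xs
                 (λ { (here refl) → xs⊆D (here refl) ; (there s∈seen) → seen⊆D s∈seen }) (xs⊆D ∘ there)
                 (λ { (here b≡x) → x≢b (sym b≡x) ; (there b∈seen) → b∉seen b∈seen }) (b∈tail b∈x∷xs) u
                 (shift ∘ covers)) ⟩
        (if a then c′ + k else suc (c′ + k))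
          ≡⟨ sym (if-float (_+ k) a) ⟩
        (if a then c′ else suc c′) + k ∎
        where
          open ≡-Reasoning
          a : Bool
          a  = any (_≈ x) seen
          c′ : ℕ
          c′ = countClasses _≈_ (x ∷ seen) (removeElt _≟_ xs b)
          b∈tail : b ∈ x ∷ xs → b ∈ xs
          b∈tail (here b≡x)  = contradiction (sym b≡x) x≢b
          b∈tail (there b∈xs) = b∈xs
          shift : ∀ {y} → y ∈ seen ⊎ y ∈ x ∷ xs → y ∈ x ∷ seen ⊎ y ∈ xs
          shift (inj₁ y∈seen)        = inj₁ (there y∈seen)
          shift (inj₂ (here y≡x))    = inj₁ (here y≡x)
          shift (inj₂ (there y∈xs)) = inj₂ y∈xs
      ... | yes refl = begin
        countClasses _∼_ seen (b ∷ xs)            ≡⟨ countClasses-head seen xs b-class b∈D seen⊆D (xs⊆D ∘ there) b∉seen b∉xs covers ⟩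
        countClasses _∼_ seen xs + k              ≡⟨ cong (_+ k) (countClasses-cong-rel _∼_ _≈_ (λ y → y ∈ D × y ≢ b) seen xs
                                                        (λ (x∈D , x≢b) (y∈D , y≢b) → sym (≈-agrees x∈D y∈D x≢b y≢b))
                                                        (λ s∈seen → seen⊆D s∈seen , λ s≡b → b∉seen (subst (_∈ seen) s≡b s∈seen))
                                                        (λ y∈xs → xs⊆D (there y∈xs) , λ y≡b → b∉xs (subst (_∈ xs) y≡b y∈xs))) ⟩
        countClasses _≈_ seen xs + k              ≡⟨ cong (λ ys → countClasses _≈_ seen ys + k) (sym (removeElt-∉ _≟_ b∉xs)) ⟩
        countClasses _≈_ seen (removeElt _≟_ xs b) + k ∎
        where
          open ≡-Reasoning
          b∉xs : b ∉ xs
          b∉xs b∈xs = All.lookup x∉xs b∈xs refl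

module CycleCount {A : Set} (_≟_ : DecidableEquality A) where
  open Orbits _≟_

  del-≡ : ∀ R {b y} → R y ≡ b → del _≟_ R b y ≡ R b
  del-≡ R {b} {y} Ry≡b with R y ≟ b
  ... | yes _    = refl
  ... | no Ry≢b = contradiction Ry≡b Ry≢b

  del-≢ : ∀ R {b y} → R y ≢ b → del _≟_ R b y ≡ R y
  del-≢ R {b} {y} Ry≢b with R y ≟ b
  ... | yes Ry≡b = contradiction Ry≡b Ry≢b
  ... | no _     = refl

  del-isPermutationOn : ∀ {D R b} → IsPermutationOn D R → b ∈ D →
                        IsPermutationOn (removeElt _≟_ D b) (del _≟_ R b)
  del-isPermutationOn {D} {R} {b} R-perm b∈D = record { closed = closed′ ; injective = injective′ }
    where
      open IsPermutationOn R-perm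
      closed′ : ∀ {x} → x ∈ removeElt _≟_ D b → del _≟_ R b x ∈ removeElt _≟_ D b
      closed′ {x} x∈D′ with ∈-removeElt⁻ _≟_ x∈D′ | R x ≟ b
      ... | x∈D , x≢b | yes Rx≡b = ∈-removeElt⁺ _≟_ (closed b∈D) λ Rb≡b → x≢b (injective x∈D b∈D (trans Rx≡b (sym Rb≡b)))
      ... | x∈D , _   | no Rx≢b  = ∈-removeElt⁺ _≟_ (closed x∈D) Rx≢b
      injective′ : ∀ {x y} → x ∈ removeElt _≟_ D b → y ∈ removeElt _≟_ D b → del _≟_ R b x ≡ del _≟_ R b y → x ≡ y
      injective′ {x} {y} x∈D′ y∈D′ e with ∈-removeElt⁻ _≟_ x∈D′ | ∈-removeElt⁻ _≟_ y∈D′ | R x ≟ b | R y ≟ b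
      ... | x∈D , _   | y∈D , _   | yes Rx≡b | yes Ry≡b = injective x∈D y∈D (trans Rx≡b (sym Ry≡b))
      ... | _         | y∈D , y≢b | yes Rx≡b | no Ry≢b  =
        contradiction (sym (injective b∈D y∈D (trans (sym (del-≡ R Rx≡b)) (trans e (del-≢ R Ry≢b))))) y≢b
      ... | x∈D , x≢b | _         | no Rx≢b  | yes Ry≡b =
        contradiction (injective x∈D b∈D (trans (sym (del-≢ R Rx≢b)) (trans e (del-≡ R Ry≡b)))) x≢b
      ... | x∈D , _   | y∈D , _   | no Rx≢b  | no Ry≢b  =
        injective x∈D y∈D (trans (sym (del-≢ R Rx≢b)) (trans e (del-≢ R Ry≢b)))

  -- The detour x ↦ b ↦ bR of R is the single step x ↦ bR of R/b.
  Reaches-del⇒Reaches : ∀ R b {x y} j → iter _≟_ (del _≟_ R b) j x ≡ y → Reaches R x y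
  Reaches-del⇒Reaches R b zero x↝y = 0 , x↝y
  Reaches-del⇒Reaches R b {x} (suc j) x↝y with Reaches-del⇒Reaches R b j x↝y | R x ≟ b
  ... | m , e | yes Rx≡b = 2 + m , trans (cong (λ z → iter _≟_ R m (R z)) Rx≡b) (trans (cong (iter _≟_ R m) (sym (del-≡ R Rx≡b))) e)
  ... | m , e | no Rx≢b  = 1 + m , trans (cong (iter _≟_ R m) (sym (del-≢ R Rx≢b))) e

  Reaches⇒Reaches-del : ∀ R b {y} m {x} → x ≢ b → y ≢ b → iter _≟_ R m x ≡ y → Reaches (del _≟_ R b) x y
  Reaches⇒Reaches-del R b zero x≢b y≢b x↝y = 0 , x↝y
  Reaches⇒Reaches-del R b (suc m) {x} x≢b y≢b x↝y with R x ≟ b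
  ... | no Rx≢b with Reaches⇒Reaches-del R b m Rx≢b y≢b x↝y
  ...   | j , e = suc j , trans (cong (iter _≟_ (del _≟_ R b) j) (del-≢ R Rx≢b)) e
  Reaches⇒Reaches-del R b (suc zero)    x≢b y≢b x↝y | yes Rx≡b = contradiction (trans (sym x↝y) Rx≡b) y≢b
  Reaches⇒Reaches-del R b {y} (suc (suc m)) {x} x≢b y≢b x↝y | yes Rx≡b
    with Reaches⇒Reaches-del R b m Rb≢b y≢b bR↝y
    where bR↝y : iter _≟_ R m (R b) ≡ y
          bR↝y = trans (cong (λ z → iter _≟_ R m (R z)) (sym Rx≡b)) x↝y
          Rb≢b : R b ≢ b
          Rb≢b Rb≡b = y≢b (trans (sym bR↝y) (trans (cong (iter _≟_ R m) Rb≡b) (iter-fixed R m Rb≡b)))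
  ... | j , e = suc j , trans (cong (iter _≟_ (del _≟_ R b) j) (del-≡ R Rx≡b)) e

  countReps≡countClasses : ∀ R n seen xs → countReps _≟_ R n seen xs ≡ countClasses (inOrbit _≟_ R n) seen xs
  countReps≡countClasses R n seen []       = refl
  countReps≡countClasses R n seen (x ∷ xs) =
    cong (λ c → if any (λ s → inOrbit _≟_ R n s x) seen then c else suc c) (countReps≡countClasses R n (x ∷ seen) xs)

  -- Deleting b shortens its cycle by one and removes it altogether exactly when b is fixed.
  ncycles-del : ∀ {D R b} → Unique D → IsPermutationOn D R → b ∈ D →
                ncycles _≟_ R D ≡ ncycles _≟_ (del _≟_ R b) (removeElt _≟_ D b) + δ _≟_ b (R b)
  ncycles-del {D} {R} {b} D-unique R-perm b∈D = begin
    ncycles _≟_ R D                               ≡⟨ countReps≡countClasses R (length D) [] D ⟩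
    countClasses _∼_ [] D                          ≡⟨ countClasses-removeElt _∼_ D (inOrbit-sym R-perm) (inOrbit-trans R-perm)
                                                        _≟_ b-class b∈D _≈_ ≈-agrees [] D (λ ()) (λ y∈D → y∈D) (λ ()) b∈D D-unique inj₂ ⟩
    countClasses _≈_ [] D′ + δ _≟_ b (R b)         ≡⟨ cong (_+ δ _≟_ b (R b)) (sym (countReps≡countClasses (del _≟_ R b) (length D′) [] D′)) ⟩
    ncycles _≟_ (del _≟_ R b) D′ + δ _≟_ b (R b)   ∎
    where
      open ≡-Reasoning
      open IsPermutationOn R-perm
      D′ : List A
      D′ = removeElt _≟_ D b
      R′-perm : IsPermutationOn D′ (del _≟_ R b)
      R′-perm = del-isPermutationOn R-perm b∈D
      _∼_ _≈_ : A → A → Bool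
      _∼_ = inOrbit _≟_ R (length D)
      _≈_ = inOrbit _≟_ (del _≟_ R b) (length D′)
      ≈-agrees : ∀ {x y} → x ∈ D → y ∈ D → x ≢ b → y ≢ b → x ≈ y ≡ x ∼ y
      ≈-agrees x∈D y∈D x≢b y≢b = true⇔true⇒≡
        (λ x≈y → let (j , e) = inOrbit⇒Reaches R′-perm x≈y in Reaches⇒inOrbit R-perm x∈D (Reaches-del⇒Reaches R b j e))
        (λ x∼y → let (m , e) = inOrbit⇒Reaches R-perm x∼y in
                 Reaches⇒inOrbit R′-perm (∈-removeElt⁺ _≟_ x∈D x≢b) (Reaches⇒Reaches-del R b m x≢b y≢b e))
      b-class : ClassIndicator _∼_ D (inOrbit-sym R-perm) (inOrbit-trans R-perm) b (δ _≟_ b (R b))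
      b-class = classOf (b ≟ R b)
        where
          classOf : (b≟Rb : Dec (b ≡ R b)) → ClassIndicator _∼_ D (inOrbit-sym R-perm) (inOrbit-trans R-perm) b (if does b≟Rb then 1 else 0)
          classOf (yes b≡Rb) = singleton λ y∈D y∼b → let (m , e) = inOrbit⇒Reaches R-perm y∼b in
                                 reaches-fixed⇒≡ R-perm m b∈D (sym b≡Rb) y∈D e
          classOf (no b≢Rb)  = nonSingleton (closed b∈D) (b≢Rb ∘ sym)
                                 (Reaches⇒inOrbit R-perm (closed b∈D) (Reaches-sym R-perm b∈D (1 , refl)))

  ncycles-cong : ∀ {D} R R′ → (∀ {x} → x ∈ D → R x ∈ D) → (∀ {x} → x ∈ D → R x ≡ R′ x) →
                 ncycles _≟_ R D ≡ ncycles _≟_ R′ D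
  ncycles-cong {D} R R′ closed R≗R′ = begin
    ncycles _≟_ R D                               ≡⟨ countReps≡countClasses R (length D) [] D ⟩
    countClasses (inOrbit _≟_ R (length D)) [] D   ≡⟨ countClasses-cong-rel _ _ (_∈ D) [] D same-orbits (λ ()) (λ x∈D → x∈D) ⟩
    countClasses (inOrbit _≟_ R′ (length D)) [] D  ≡⟨ sym (countReps≡countClasses R′ (length D) [] D) ⟩
    ncycles _≟_ R′ D                              ∎
    where
      open ≡-Reasoning
      iter-cong : ∀ j {x} → x ∈ D → iter _≟_ R j x ≡ iter _≟_ R′ j x
      iter-cong zero    x∈D = refl
      iter-cong (suc j) x∈D = trans (iter-cong j (closed x∈D)) (cong (iter _≟_ R′ j) (R≗R′ x∈D))
      same-orbits : ∀ {x y} → x ∈ D → y ∈ D → inOrbit _≟_ R (length D) x y ≡ inOrbit _≟_ R′ (length D) x y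
      same-orbits {x} {y} x∈D _ = any-cong _ _ (upTo (length D)) λ {j} _ → cong (λ z → _==_ _≟_ z y) (iter-cong j x∈D)

  module _ {E : List A} {Q : A → A} (Q-injective : ∀ {u v} → u ∈ E → v ∈ E → Q u ≡ Q v → u ≡ v)
           {c : A} (Qc≡c : Q c ≡ c) (c∈E : c ∈ E) where

    -- Since Q fixes c, it only ever maps c to itself, so deleting c commutes with composing with Q.
    del-∘-fixed : ∀ R P y → P y ∈ E → R y ≡ Q (P y) → R c ≡ Q (P c) → del _≟_ R c y ≡ Q (del _≟_ P c y)
    del-∘-fixed R P y Py∈E Ry Rc with P y ≟ c
    ... | yes Py≡c = trans (del-≡ R (trans Ry (trans (cong Q Py≡c) Qc≡c))) Rc
    ... | no Py≢c  = trans (del-≢ R λ Ry≡c → Py≢c (Q-injective Py∈E c∈E (trans (sym Ry) (trans Ry≡c (sym Qc≡c))))) Ry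

    δ-fixed : ∀ z → z ∈ E → δ _≟_ c (Q z) ≡ δ _≟_ c z
    δ-fixed z z∈E = cong (λ t → if t then 1 else 0) (does-⇔ (mk⇔
      (λ c≡Qz → Q-injective c∈E z∈E (trans Qc≡c c≡Qz)) (λ c≡z → trans (sym Qc≡c) (cong Q c≡z))) (c ≟ Q z) (c ≟ z))

module CyclePermutations {A : Set} (_≟_ : DecidableEquality A) where

  nextIn-just : ∀ h x l y {z} → nextIn _≟_ h (x ∷ l) y ≡ just z → z ≡ h ⊎ z ∈ l
  nextIn-just h x []        y e with x ≟ y
  nextIn-just h x []        y refl | yes _ = inj₁ refl
  nextIn-just h x (x′ ∷ xs) y e with x ≟ y
  nextIn-just h x (x′ ∷ xs) y refl | yes _ = inj₂ (here refl)
  ... | no _ with nextIn-just h x′ xs y e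
  ...   | inj₁ z≡h  = inj₁ z≡h
  ...   | inj₂ z∈xs = inj₂ (there z∈xs)

  nextIn-∈ : ∀ h t y {z} → nextIn _≟_ h (h ∷ t) y ≡ just z → z ∈ h ∷ t
  nextIn-∈ h t y e with nextIn-just h h t y e
  ... | inj₁ refl = here refl
  ... | inj₂ z∈t  = there z∈t

  nextIn-∉ : ∀ h x l y → y ∉ x ∷ l → nextIn _≟_ h (x ∷ l) y ≡ nothing
  nextIn-∉ h x []        y y∉ with x ≟ y
  ... | yes x≡y = contradiction (here (sym x≡y)) y∉
  ... | no _    = refl
  nextIn-∉ h x (x′ ∷ xs) y y∉ with x ≟ y
  ... | yes x≡y = contradiction (here (sym x≡y)) y∉
  ... | no _    = nextIn-∉ h x′ xs y (y∉ ∘ there)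

  nextIn-≢nothing : ∀ h x l y → y ∈ x ∷ l → nextIn _≟_ h (x ∷ l) y ≢ nothing
  nextIn-≢nothing h x []        y y∈ e with x ≟ y
  nextIn-≢nothing h x []        y (here refl) e | no x≢x = x≢x refl
  nextIn-≢nothing h x (x′ ∷ xs) y y∈ e with x ≟ y
  nextIn-≢nothing h x (x′ ∷ xs) y (here refl) e  | no x≢x = x≢x refl
  nextIn-≢nothing h x (x′ ∷ xs) y (there y∈xs) e | no _   = nextIn-≢nothing h x′ xs y y∈xs e

  nextIn-injective : ∀ h x l {y y′ z} → Unique (x ∷ l) → h ∉ l →
    nextIn _≟_ h (x ∷ l) y ≡ just z → nextIn _≟_ h (x ∷ l) y′ ≡ just z → y ≡ y′
  nextIn-injective h x []        {y} {y′} u h∉l e e′ with x ≟ y | x ≟ y′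
  ... | yes x≡y | yes x≡y′ = trans (sym x≡y) x≡y′
  nextIn-injective h x (x′ ∷ xs) {y} {y′} u h∉l e e′ with x ≟ y | x ≟ y′
  ... | yes x≡y | yes x≡y′ = trans (sym x≡y) x≡y′
  nextIn-injective h x (x′ ∷ xs) {y} {y′} (_ ∷ x′∉xs ∷ _) h∉l refl e′ | yes _ | no _ with nextIn-just h x′ xs y′ e′
  ... | inj₁ x′≡h  = contradiction (here (sym x′≡h)) h∉l
  ... | inj₂ x′∈xs = contradiction refl (All.lookup x′∉xs x′∈xs)
  nextIn-injective h x (x′ ∷ xs) {y} {y′} (_ ∷ x′∉xs ∷ _) h∉l e refl | no _ | yes _ with nextIn-just h x′ xs y e
  ... | inj₁ x′≡h  = contradiction (here (sym x′≡h)) h∉l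
  ... | inj₂ x′∈xs = contradiction refl (All.lookup x′∉xs x′∈xs)
  nextIn-injective h x (x′ ∷ xs) (_ ∷ u) h∉l e e′ | no _ | no _ = nextIn-injective h x′ xs u (h∉l ∘ there) e e′

  nextIn-nothing⇒∈-rest : ∀ h t {ys w} → nextIn _≟_ h (h ∷ t) w ≡ nothing → w ∈ (h ∷ t) ++ ys → w ∈ ys
  nextIn-nothing⇒∈-rest h t {w = w} ew w∈ with ∈-++⁻ (h ∷ t) w∈
  ... | inj₁ w∈h∷t = contradiction ew (nextIn-≢nothing h h t w w∈h∷t)
  ... | inj₂ w∈ys  = w∈ys

  cycFun-∈ : ∀ cs {c y} → Unique (concat cs) → c ∈ cs → y ∈ c → cycFun _≟_ cs y ∈ c
  cycFun-∈ ([] ∷ cs) u (here refl) ()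
  cycFun-∈ ([] ∷ cs) u (there c∈cs) y∈c = cycFun-∈ cs u c∈cs y∈c
  cycFun-∈ ((h ∷ t) ∷ cs) {c} {y} u c∈ y∈c with nextIn _≟_ h (h ∷ t) y in e | c∈
  ... | just z  | here refl   = nextIn-∈ h t y e
  ... | nothing | here refl   = contradiction e (nextIn-≢nothing h h t y y∈c)
  ... | just z  | there c∈cs =
    contradiction (trans (sym e) (nextIn-∉ h h t y λ y∈h∷t → proj₂ (proj₂ (Unique-++⁻ (h ∷ t) u)) y∈h∷t (∈-concat⁺′ y∈c c∈cs))) λ ()
  ... | nothing | there c∈cs = cycFun-∈ cs (proj₁ (proj₂ (Unique-++⁻ (h ∷ t) u))) c∈cs y∈c

  cycFun-closed : ∀ cs {y} → Unique (concat cs) → y ∈ concat cs → cycFun _≟_ cs y ∈ concat cs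
  cycFun-closed cs u y∈ = let (c , y∈c , c∈cs) = ∈-concat⁻′ cs y∈ in ∈-concat⁺′ (cycFun-∈ cs u c∈cs y∈c) c∈cs

  cycFun-injective : ∀ cs {y y′} → Unique (concat cs) → y ∈ concat cs → y′ ∈ concat cs →
                     cycFun _≟_ cs y ≡ cycFun _≟_ cs y′ → y ≡ y′
  cycFun-injective ([] ∷ cs) u y∈ y′∈ e = cycFun-injective cs u y∈ y′∈ e
  cycFun-injective ((h ∷ t) ∷ cs) {y} {y′} u y∈ y′∈ e
    with Unique-++⁻ (h ∷ t) u | nextIn _≟_ h (h ∷ t) y in ey | nextIn _≟_ h (h ∷ t) y′ in ey′
  ... | u-head , _ , _ | just _ | just _ =
    nextIn-injective h h t u-head (Unique[x∷xs]⇒x∉xs u-head) ey (trans ey′ (cong just (sym e)))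
  ... | _ , u-tail , disjoint | just _ | nothing =
    contradiction (subst (_∈ concat cs) (sym e) (cycFun-closed cs u-tail (nextIn-nothing⇒∈-rest h t ey′ y′∈))) (disjoint (nextIn-∈ h t y ey))
  ... | _ , u-tail , disjoint | nothing | just _ =
    contradiction (subst (_∈ concat cs) e (cycFun-closed cs u-tail (nextIn-nothing⇒∈-rest h t ey y∈))) (disjoint (nextIn-∈ h t y′ ey′))
  ... | _ , u-tail , _ | nothing | nothing =
    cycFun-injective cs u-tail (nextIn-nothing⇒∈-rest h t ey y∈) (nextIn-nothing⇒∈-rest h t ey′ y′∈) e

  cycFun-isPermutationOn : ∀ cs → Unique (concat cs) → IsPermutationOn (concat cs) (cycFun _≟_ cs)
  cycFun-isPermutationOn cs u = record { closed = cycFun-closed cs u ; injective = cycFun-injective cs u }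

  cycFun-removeSingleton : ∀ xs ys c y → c ≢ y → cycFun _≟_ (xs ++ (c ∷ []) ∷ ys) y ≡ cycFun _≟_ (xs ++ ys) y
  cycFun-removeSingleton []              ys c y c≢y with c ≟ y
  ... | yes c≡y = contradiction c≡y c≢y
  ... | no _    = refl
  cycFun-removeSingleton ([] ∷ xs)       ys c y c≢y = cycFun-removeSingleton xs ys c y c≢y
  cycFun-removeSingleton ((h ∷ t) ∷ xs)  ys c y c≢y with nextIn _≟_ h (h ∷ t) y
  ... | just _  = refl
  ... | nothing = cycFun-removeSingleton xs ys c y c≢y

module Orderings {A : Set} (_≟_ : DecidableEquality A) where

  insertAll-↭ : ∀ x ys → All (_↭ x ∷ ys) (insertAll _≟_ x ys)
  insertAll-↭ x []       = ↭-refl ∷ []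
  insertAll-↭ x (y ∷ ys) =
    ↭-refl ∷ All-map⁺ (All.map (λ o↭ → ↭.trans (prep y o↭) (swap y x ↭-refl)) (insertAll-↭ x ys))

  perms-↭ : ∀ B → All (_↭ B) (perms _≟_ B)
  perms-↭ []       = ↭-refl ∷ []
  perms-↭ (x ∷ xs) = All-concat⁺ (All-map⁺ (All.map (λ o↭ → All.map (λ p↭ → ↭.trans p↭ (prep x o↭)) (insertAll-↭ x _)) (perms-↭ xs)))

  choices-↭ : ∀ Π → All (λ os → Pointwise _↭_ os Π) (choices _≟_ Π)
  choices-↭ []      = [] ∷ []
  choices-↭ (B ∷ Π) = All-concat⁺ (All-map⁺ (All.map (λ o↭ → All-map⁺ (All.map (o↭ ∷_) (choices-↭ Π))) (perms-↭ B)))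

  RemovesSingleton : A → List (List A) → List (List A) → Set
  RemovesSingleton b os os′ = ∃₂ λ o₁ o₂ → os ≡ o₁ ++ (b ∷ []) ∷ o₂ × os′ ≡ o₁ ++ o₂

  choices-removeSingleton : ∀ b Π₁ Π₂ →
    Pointwise (RemovesSingleton b) (choices _≟_ (Π₁ ++ (b ∷ []) ∷ Π₂)) (choices _≟_ (Π₁ ++ Π₂))
  choices-removeSingleton b [] Π₂ =
    subst (λ l → Pointwise (RemovesSingleton b) l (choices _≟_ Π₂)) (sym (++-identityʳ _))
      (prepend-b (choices _≟_ Π₂))
    where
      prepend-b : ∀ L → Pointwise (RemovesSingleton b) (map ((b ∷ []) ∷_) L) L
      prepend-b []       = []
      prepend-b (os ∷ L) = ([] , os , refl , refl) ∷ prepend-b L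
  choices-removeSingleton b (B ∷ Π₁) Π₂ = Pointwise.concat⁺ (Pointwise.map⁺ _ _ (Pointwise.refl (λ {o} →
    Pointwise.map⁺ _ _ (Pointwise.map (λ (o₁ , o₂ , e , e′) → o ∷ o₁ , o₂ , cong (o ∷_) e , cong (o ∷_) e′)
                                      (choices-removeSingleton b Π₁ Π₂))) {perms _≟_ B}))

+[a+y+x]≡m⇔+a≡m-x-y : ∀ a x y (m : ℤ) → (+ (a + y + x) ≡ m) ⇔ (+ a ≡ m - + x - + y)
+[a+y+x]≡m⇔+a≡m-x-y a x y m = mk⇔
  (λ e → trans (shift-left (+ a) (+ x) (+ y)) (cong (λ t → t - + x - + y) (trans (sym (pos-+₃ a y x)) e)))
  (λ e → trans (pos-+₃ a y x) (trans (cong (λ t → t ℤ.+ + y ℤ.+ + x) e) (shift-right m (+ x) (+ y))))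
  where
    pos-+₃ : ∀ a y x → + (a + y + x) ≡ + a ℤ.+ + y ℤ.+ + x
    pos-+₃ a y x = trans (ℤ.pos-+ (a + y) x) (cong (ℤ._+ + x) (ℤ.pos-+ a y))
    shift-left : ∀ a x y → a ≡ a ℤ.+ y ℤ.+ x - x - y
    shift-left = solve-∀
    shift-right : ∀ m x y → m - x - y ℤ.+ y ℤ.+ x ≡ m
    shift-right = solve-∀

module FixedPair {A : Set} (_≟_ : DecidableEquality A) (θ : A → A) (S : List A) (P : A → A)
                 (Π₁ Π₂ : List (List A)) (b : A)
                 (setup : IsInvolutionSetup _≟_ θ S)
                 (pair : IsPBPair _≟_ θ S P (Π₁ ++ (b ∷ []) ∷ Π₂)) where
  open CycleCount _≟_
  open CyclePermutations _≟_
  open Orderings _≟_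
  open IsInvolutionSetup setup
  open IsPBPair pair

  Π Π′ : List (List A)
  Π  = Π₁ ++ (b ∷ []) ∷ Π₂
  Π′ = Π₁ ++ Π₂

  D D₁ D₂ S′ D′ : List A
  D  = dom _≟_ θ S
  D₁ = removeElt _≟_ D b
  D₂ = removeElt _≟_ D₁ (θ b)
  S′ = removeElt _≟_ S b
  D′ = dom _≟_ θ S′

  P₁ P′ : A → A
  P₁ = del _≟_ P b
  P′ = del _≟_ P₁ (θ b)

  b∈S : b ∈ S
  b∈S = ↭.∈-resp-↭ covers (∈-concat⁺′ (here refl) (∈-++⁺ʳ Π₁ (here refl)))

  θ-injective : ∀ {x y} → x ∈ S → y ∈ S → θ x ≡ θ y → x ≡ y
  θ-injective x∈S y∈S e = trans (sym (involutive x∈S)) (trans (cong θ e) (involutive y∈S))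

  θb∉S : θ b ∉ S
  θb∉S = disjoint b∈S

  b∉θS : b ∉ map θ S
  b∉θS b∈θS = let (a , a∈S , b≡θa) = ∈-map⁻ θ b∈θS in
    θb∉S (subst (_∈ S) (trans (sym (involutive a∈S)) (cong θ (sym b≡θa))) a∈S)

  b∈D : b ∈ D
  b∈D = ∈-++⁺ˡ b∈S

  θb∈D₁ : θ b ∈ D₁
  θb∈D₁ = ∈-removeElt⁺ _≟_ (∈-++⁺ʳ S (∈-map⁺ θ b∈S)) λ θb≡b → θb∉S (subst (_∈ S) (sym θb≡b) b∈S)

  D-unique : Unique D
  D-unique = Unique.++⁺ uniqueS (θS-unique S (λ x∈S → x∈S) uniqueS)
    λ (z∈S , z∈θS) → let (a , a∈S , z≡θa) = ∈-map⁻ θ z∈θS in disjoint a∈S (subst (_∈ S) z≡θa z∈S)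
    where
      θS-unique : ∀ xs → (∀ {x} → x ∈ xs → x ∈ S) → Unique xs → Unique (map θ xs)
      θS-unique []       _    _          = []
      θS-unique (x ∷ xs) xs⊆S (x∉ ∷ u) =
        All-map⁺ (All.tabulate λ y∈xs θx≡θy → All.lookup x∉ y∈xs (θ-injective (xs⊆S (here refl)) (xs⊆S (there y∈xs)) θx≡θy))
        ∷ θS-unique xs (xs⊆S ∘ there) u

  P-perm : IsPermutationOn D P
  P-perm = record { closed = closed ; injective = injective }

  P₁-perm : IsPermutationOn D₁ P₁
  P₁-perm = del-isPermutationOn P-perm b∈D

  D₂≡D′ : D₂ ≡ D′
  D₂≡D′ = begin
    removeElt _≟_ (removeElt _≟_ (S ++ map θ S) b) (θ b)
      ≡⟨ cong (λ xs → removeElt _≟_ xs (θ b)) (trans (removeElt-++ _≟_ S (map θ S) b) (cong (S′ ++_) (removeElt-∉ _≟_ b∉θS))) ⟩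
    removeElt _≟_ (S′ ++ map θ S) (θ b)
      ≡⟨ removeElt-++ _≟_ S′ (map θ S) (θ b) ⟩
    removeElt _≟_ S′ (θ b) ++ removeElt _≟_ (map θ S) (θ b)
      ≡⟨ cong₂ _++_ (removeElt-∉ _≟_ (θb∉S ∘ proj₁ ∘ ∈-removeElt⁻ _≟_)) (removeElt-map _≟_ θ b S λ x∈S → θ-injective x∈S b∈S) ⟩
    S′ ++ map θ S′ ∎
    where open ≡-Reasoning

  ∈D′⁻ : ∀ {y} → y ∈ D′ → y ∈ D × y ≢ b × y ≢ θ b
  ∈D′⁻ y∈D′ = let (y∈D₁ , y≢θb) = ∈-removeElt⁻ _≟_ (subst (_ ∈_) (sym D₂≡D′) y∈D′)
                  (y∈D , y≢b)   = ∈-removeElt⁻ _≟_ y∈D₁ in y∈D , y≢b , y≢θb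

  ∈D′⁺ : ∀ {y} → y ∈ D → y ≢ b → y ≢ θ b → y ∈ D′
  ∈D′⁺ y∈D y≢b y≢θb = subst (_ ∈_) D₂≡D′ (∈-removeElt⁺ _≟_ (∈-removeElt⁺ _≟_ y∈D y≢b) y≢θb)

  cycles : List (List A) → List (List A)
  cycles os = os ++ map (reverse ∘ map θ) os

  cycles-↭ : ∀ os → Pointwise _↭_ os Π → concat (cycles os) ↭ D
  cycles-↭ os os↭Π = subst (_↭ D) (concat-++ os (map (reverse ∘ map θ) os))
    (↭.++⁺ blocks↭S (↭.trans (reversed-blocks os) (↭.map⁺ θ blocks↭S)))
    where
      blocks↭S : concat os ↭ S
      blocks↭S = ↭.trans (concat-↭ os↭Π) covers
      reversed-blocks : ∀ os → concat (map (reverse ∘ map θ) os) ↭ map θ (concat os)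
      reversed-blocks []       = ↭-refl
      reversed-blocks (o ∷ os) = ↭.trans (↭.++⁺ (↭.↭-reverse (map θ o)) (reversed-blocks os))
                                         (↭.↭-reflexive (sym (map-++ θ o (concat os))))

  record FixedPairExtension (Q Q′ : A → A) : Set where
    field
      permutation : IsPermutationOn D Q
      fixes-b     : Q b ≡ b
      fixes-θb    : Q (θ b) ≡ θ b
      agrees      : ∀ y → y ≢ b → y ≢ θ b → Q y ≡ Q′ y

  embeddingOf-extension : ∀ os os′ → RemovesSingleton b os os′ → Pointwise _↭_ os Π →
                          FixedPairExtension (embeddingOf _≟_ θ os) (embeddingOf _≟_ θ os′)
  embeddingOf-extension _ _ (o₁ , o₂ , refl , refl) os↭Π = record
    { permutation = ↭-isPermutationOn (cycles-↭ os os↭Π) (cycFun-isPermutationOn (cycles os) cycles-unique)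
    ; fixes-b     = ∈-singleton (cycFun-∈ (cycles os) cycles-unique (∈-++⁺ˡ ∈-b) (here refl))
    ; fixes-θb    = ∈-singleton (cycFun-∈ (cycles os) cycles-unique (∈-++⁺ʳ os (∈-map⁺ (reverse ∘ map θ) ∈-b)) (here refl))
    ; agrees      = agrees
    }
    where
      os : List (List A)
      os = o₁ ++ (b ∷ []) ∷ o₂
      g : List A → List A
      g = reverse ∘ map θ
      ∈-b : (b ∷ []) ∈ os
      ∈-b = ∈-++⁺ʳ o₁ (here refl)
      cycles-unique : Unique (concat (cycles os))
      cycles-unique = Unique-resp-↭ (↭-sym (cycles-↭ os os↭Π)) D-unique
      ∈-singleton : ∀ {x y : A} → x ∈ y ∷ [] → x ≡ y
      ∈-singleton (here x≡y) = x≡y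
      agrees : ∀ y → y ≢ b → y ≢ θ b → cycFun _≟_ (cycles os) y ≡ cycFun _≟_ (cycles (o₁ ++ o₂)) y
      agrees y y≢b y≢θb = begin
        cycFun _≟_ (cycles os) y
          ≡⟨ cong (λ cs → cycFun _≟_ cs y) (trans (++-assoc o₁ _ _) (cong (λ l → o₁ ++ (b ∷ []) ∷ (o₂ ++ l)) (map-++ g o₁ _))) ⟩
        cycFun _≟_ (o₁ ++ (b ∷ []) ∷ (o₂ ++ map g o₁ ++ (θ b ∷ []) ∷ map g o₂)) y
          ≡⟨ cycFun-removeSingleton o₁ _ b y (y≢b ∘ sym) ⟩
        cycFun _≟_ (o₁ ++ o₂ ++ map g o₁ ++ (θ b ∷ []) ∷ map g o₂) y
          ≡⟨ cong (λ cs → cycFun _≟_ cs y) (sym (trans (++-assoc o₁ _ _) (cong (o₁ ++_) (++-assoc o₂ _ _)))) ⟩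
        cycFun _≟_ ((o₁ ++ o₂ ++ map g o₁) ++ (θ b ∷ []) ∷ map g o₂) y
          ≡⟨ cycFun-removeSingleton (o₁ ++ o₂ ++ map g o₁) _ (θ b) y (y≢θb ∘ sym) ⟩
        cycFun _≟_ ((o₁ ++ o₂ ++ map g o₁) ++ map g o₂) y
          ≡⟨ cong (λ cs → cycFun _≟_ cs y) (trans (trans (++-assoc o₁ _ _) (cong (o₁ ++_) (++-assoc o₂ _ _)))
                                              (cong (λ l → o₁ ++ o₂ ++ l) (sym (map-++ g o₁ o₂)))) ⟩
        cycFun _≟_ (o₁ ++ o₂ ++ map g (o₁ ++ o₂)) y
          ≡⟨ cong (λ cs → cycFun _≟_ cs y) (sym (++-assoc o₁ o₂ _)) ⟩
        cycFun _≟_ (cycles (o₁ ++ o₂)) y ∎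
        where open ≡-Reasoning

  agreeOn-extension : ∀ {Q Q′ R R′} → FixedPairExtension Q Q′ → FixedPairExtension R R′ →
                      agreeOn _≟_ D Q R ≡ agreeOn _≟_ D′ Q′ R′
  agreeOn-extension {Q} {Q′} {R} {R′} Q-ext R-ext = true⇔true⇒≡
    (λ Q≗R → all≡true⁺ _ D′ λ {y} y∈D′ → let (y∈D , y≢b , y≢θb) = ∈D′⁻ y∈D′ in
      dec-true (Q′ y ≟ R′ y) (trans (sym (Q.agrees y y≢b y≢θb)) (trans (==⇒≡ _≟_ (all≡true⁻ _ D Q≗R y∈D)) (R.agrees y y≢b y≢θb))))
    (λ Q′≗R′ → all≡true⁺ _ D λ {y} y∈D → dec-true (Q y ≟ R y) (agree-at y y∈D Q′≗R′))
    where
      module Q = FixedPairExtension Q-ext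
      module R = FixedPairExtension R-ext
      agree-at : ∀ y → y ∈ D → agreeOn _≟_ D′ Q′ R′ ≡ true → Q y ≡ R y
      agree-at y y∈D Q′≗R′ with y ≟ b | y ≟ θ b
      ... | yes refl | _        = trans Q.fixes-b (sym R.fixes-b)
      ... | no _     | yes refl = trans Q.fixes-θb (sym R.fixes-θb)
      ... | no y≢b   | no y≢θb  = trans (Q.agrees y y≢b y≢θb)
        (trans (==⇒≡ _≟_ (all≡true⁻ _ D′ Q′≗R′ (∈D′⁺ y∈D y≢b y≢θb))) (sym (R.agrees y y≢b y≢θb)))

  ncycles-extension : ∀ {Q Q′} → FixedPairExtension Q Q′ →
    ncycles _≟_ (Q ∘ P) D ≡ ncycles _≟_ (Q′ ∘ P′) D′ + δ _≟_ (θ b) (P₁ (θ b)) + δ _≟_ b (P b)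
  ncycles-extension {Q} {Q′} Q-ext = begin
    ncycles _≟_ (Q ∘ P) D
      ≡⟨ ncycles-del D-unique QP-perm b∈D ⟩
    ncycles _≟_ R₁ D₁ + δ _≟_ b (Q (P b))
      ≡⟨ cong₂ _+_ (ncycles-del (removeElt-unique _≟_ b D-unique) R₁-perm θb∈D₁) (δ-fixed Q-injective fixes-b b∈D (P b) (P-closed b∈D)) ⟩
    ncycles _≟_ R₂ D₂ + δ _≟_ (θ b) (R₁ (θ b)) + δ _≟_ b (P b)
      ≡⟨ cong (λ n → n + δ _≟_ (θ b) (R₁ (θ b)) + δ _≟_ b (P b)) R₂-cycles ⟩
    ncycles _≟_ (Q′ ∘ P′) D′ + δ _≟_ (θ b) (R₁ (θ b)) + δ _≟_ b (P b)
      ≡⟨ cong (λ d → ncycles _≟_ (Q′ ∘ P′) D′ + d + δ _≟_ b (P b))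
              (trans (cong (δ _≟_ (θ b)) (R₁≗QP₁ θb∈D₁)) (δ-fixed Q-injective₁ fixes-θb θb∈D₁ (P₁ (θ b)) (P₁-closed θb∈D₁))) ⟩
    ncycles _≟_ (Q′ ∘ P′) D′ + δ _≟_ (θ b) (P₁ (θ b)) + δ _≟_ b (P b) ∎
    where
      open ≡-Reasoning
      open FixedPairExtension Q-ext
      open IsPermutationOn permutation renaming (injective to Q-injective)
      open IsPermutationOn P-perm renaming (closed to P-closed)
      open IsPermutationOn P₁-perm renaming (closed to P₁-closed)
      QP-perm : IsPermutationOn D (Q ∘ P)
      QP-perm = ∘-isPermutationOn permutation P-perm
      R₁ R₂ : A → A
      R₁ = del _≟_ (Q ∘ P) b
      R₂ = del _≟_ R₁ (θ b)
      R₁-perm : IsPermutationOn D₁ R₁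
      R₁-perm = del-isPermutationOn QP-perm b∈D
      Q-injective₁ : ∀ {u v} → u ∈ D₁ → v ∈ D₁ → Q u ≡ Q v → u ≡ v
      Q-injective₁ u∈D₁ v∈D₁ = Q-injective (proj₁ (∈-removeElt⁻ _≟_ u∈D₁)) (proj₁ (∈-removeElt⁻ _≟_ v∈D₁))
      R₁≗QP₁ : ∀ {y} → y ∈ D₁ → R₁ y ≡ Q (P₁ y)
      R₁≗QP₁ {y} y∈D₁ = del-∘-fixed Q-injective fixes-b b∈D (Q ∘ P) P y (P-closed (proj₁ (∈-removeElt⁻ _≟_ y∈D₁))) refl refl
      R₂≗QP′ : ∀ {y} → y ∈ D₂ → R₂ y ≡ Q (P′ y)
      R₂≗QP′ {y} y∈D₂ = let y∈D₁ = proj₁ (∈-removeElt⁻ _≟_ y∈D₂) in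
        del-∘-fixed Q-injective₁ fixes-θb θb∈D₁ R₁ P₁ y (P₁-closed y∈D₁) (R₁≗QP₁ y∈D₁) (R₁≗QP₁ θb∈D₁)
      R₂-cycles : ncycles _≟_ R₂ D₂ ≡ ncycles _≟_ (Q′ ∘ P′) D′
      R₂-cycles = trans
        (ncycles-cong R₂ (Q′ ∘ P′) (IsPermutationOn.closed (del-isPermutationOn R₁-perm θb∈D₁)) λ {y} y∈D₂ →
           let (_ , P′y≢b , P′y≢θb) = ∈D′⁻ (subst (P′ y ∈_) D₂≡D′ (IsPermutationOn.closed (del-isPermutationOn P₁-perm θb∈D₁) y∈D₂)) in
           trans (R₂≗QP′ y∈D₂) (agrees (P′ y) P′y≢b P′y≢θb))
        (cong (ncycles _≟_ (Q′ ∘ P′)) D₂≡D′)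

  removeBlock-singleton : removeBlock _≟_ Π b ≡ Π′
  removeBlock-singleton = begin
    removeElt _≡?_ (Π₁ ++ (b ∷ []) ∷ Π₂) (b ∷ [])                      ≡⟨ removeElt-++ _≡?_ Π₁ _ (b ∷ []) ⟩
    removeElt _≡?_ Π₁ (b ∷ []) ++ removeElt _≡?_ ((b ∷ []) ∷ Π₂) (b ∷ []) ≡⟨ cong₂ _++_ (removeElt-∉ _≡?_ b∉Π₁) (removeElt-head _≡?_ Π₂ (b ∷ [])) ⟩
    Π₁ ++ removeElt _≡?_ Π₂ (b ∷ [])                                  ≡⟨ cong (Π₁ ++_) (removeElt-∉ _≡?_ b∉Π₂) ⟩
    Π₁ ++ Π₂                                                          ∎
    where
      open ≡-Reasoning
      _≡?_ : DecidableEquality (List A)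
      _≡?_ = ≡-dec _≟_
      split : Unique (concat Π₁) × Unique (b ∷ concat Π₂) × (∀ {z} → z ∈ concat Π₁ → z ∉ b ∷ concat Π₂)
      split = Unique-++⁻ (concat Π₁) (subst Unique (sym (concat-++ Π₁ ((b ∷ []) ∷ Π₂)))
                                           (Unique-resp-↭ (↭-sym covers) uniqueS))
      b∉Π₁ : (b ∷ []) ∉ Π₁
      b∉Π₁ b∈Π₁ = proj₂ (proj₂ split) (∈-concat⁺′ (here refl) b∈Π₁) (here refl)
      b∉Π₂ : (b ∷ []) ∉ Π₂
      b∉Π₂ b∈Π₂ = Unique[x∷xs]⇒x∉xs (proj₁ (proj₂ split)) (∈-concat⁺′ (here refl) b∈Π₂)

  r-removeSingleton : ∀ m → r _≟_ θ S P Π m ≡ r _≟_ θ S′ P′ Π′ (m - + δ _≟_ b (P b) - + δ _≟_ (θ b) (P₁ (θ b)))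
  r-removeSingleton m = length-filterB-pointwise FixedPairExtension _ _
    (λ {Q} {Q′} Q-ext → trans (cong (λ n → does (+ n ℤ.≟ m)) (ncycles-extension Q-ext))
                              (does-⇔ (+[a+y+x]≡m⇔+a≡m-x-y (ncycles _≟_ (Q′ ∘ P′) D′) d₁ d₂ m) (_ ℤ.≟ m) (_ ℤ.≟ m - + d₁ - + d₂)))
    (distinctOn-pointwise _≟_ FixedPairExtension D D′ agreeOn-extension []
      (Pointwise.map⁺ (embeddingOf _≟_ θ) (embeddingOf _≟_ θ)
        (Pointwise-mapWithAll (embeddingOf-extension _ _) (choices-removeSingleton b Π₁ Π₂) (choices-↭ Π))))
    where
      d₁ d₂ : ℕ
      d₁ = δ _≟_ b (P b)
      d₂ = δ _≟_ (θ b) (P₁ (θ b))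

mainTheorem4 : {A : Set} (_≟_ : DecidableEquality A) (θ : A → A)
    (S : List A) (P : A → A) (Π : List (List A)) (b : A) →
    IsInvolutionSetup _≟_ θ S →
    IsPBPair _≟_ θ S P Π →
    (b ∷ []) ∈ Π →
    (k : ℤ) →
    r _≟_ θ S P Π (+ 2 * k)
      ≡ r _≟_ θ (removeElt _≟_ S b) (del _≟_ (del _≟_ P b) (θ b)) (removeBlock _≟_ Π b)
          (+ 2 * k - + δ _≟_ b (P b) - + δ _≟_ (θ b) (del _≟_ P b (θ b)))
mainTheorem4 _≟_ θ S P Π b setup pair b∈Π k with ∈-∃++ b∈Π
... | Π₁ , Π₂ , refl =
  trans (r-removeSingleton (+ 2 * k))
        (cong (λ Π′ → r _≟_ θ S′ P′ Π′ (+ 2 * k - + δ _≟_ b (P b) - + δ _≟_ (θ b) (P₁ (θ b)))) (sym removeBlock-singleton))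
  where open FixedPair _≟_ θ S P Π₁ Π₂ b setup pair
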